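{- Let $d=d(n)$, $m=m(n)$, $s=s(n)$ satisfy $s>3dmn^d$. Then a uniformly random function $f\colon\{0,1\}^n\to\{0,1\}$ is a $(d,m,s)$-disperser with probability $1-o(1)$ (as $n\to\infty$).
   Context: A set $S\subseteq\{0,1\}^n$ is a $(d,m)$-variety if $S=\{x: p_1(x)=\dots=p_{m'}(x)=0\}$ for some $m'\le m$ polynomials $p_i$ over $\mathbb{F}_2$ of degree at most $d$. A function $f$ is a $(d,m,s)$-disperser if $f$ is non-constant on every $(d,m)$-variety of size larger than $s$. -}

module Defs where

open import Data.Bool using (Bool; true; false; not; _∧_; _∨_; _xor_)
open import Data.Nat using (ℕ; zero; suc; _+_; _*_; _^_; _≤_; _<_)
open import Data.List using (List; []; _∷_; length; filter; map; _++_; foldr)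
open import Data.List.Relation.Unary.All using (All)
open import Data.List.Relation.Unary.Any using (Any)
open import Data.Vec using (Vec; []; _∷_)
open import Data.Product using (Σ; ∃; _×_; _,_)
open import Relation.Binary.PropositionalEquality using (_≡_; _≢_)
open import Relation.Nullary using (¬_)
open import Data.Bool using (T)
open import Relation.Nullary.Decidable using (Dec)
open import Data.Bool.Properties using (T?)

-- A point of the Boolean cube {0,1}^n (false = 0, true = 1).
Point : ℕ → Set
Point n = Vec Bool n

-- A multilinear monomial: the set of variables it contains (indicator vector).
Monomial : ℕ → Set
Monomial n = Vec Bool n

degM : ∀ {n} → Monomial n → ℕ
degM [] = 0
degM (true ∷ m) = suc (degM m)
degM (false ∷ m) = degM m

evalM : ∀ {n} → Monomial n → Point n → Bool
evalM [] [] = true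
evalM (b ∷ m) (x ∷ xs) = (not b ∨ x) ∧ evalM m xs

-- A polynomial over F_2 in n variables, given as a (formal) sum of monomials.
-- (On {0,1}^n every polynomial agrees with a multilinear one of no larger degree.)
Poly : ℕ → Set
Poly n = List (Monomial n)

DegLe : ∀ {n} → ℕ → Poly n → Set
DegLe d p = All (λ m → degM m ≤ d) p

evalP : ∀ {n} → Poly n → Point n → Bool
evalP p x = foldr (λ m acc → evalM m x xor acc) false p

inVariety : ∀ {n} → List (Poly n) → Point n → Bool
inVariety [] x = true
inVariety (p ∷ ps) x = not (evalP p x) ∧ inVariety ps x

allPoints : (n : ℕ) → List (Point n)
allPoints zero = [] ∷ []
allPoints (suc n) = map (false ∷_) (allPoints n) ++ map (true ∷_) (allPoints n)

variety : ∀ {n} → List (Poly n) → List (Point n)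
variety {n} ps = filter (λ x → T? (inVariety ps x)) (allPoints n)

varietySize : ∀ {n} → List (Poly n) → ℕ
varietySize ps = length (variety ps)

IsDMSystem : ∀ {n} → ℕ → ℕ → List (Poly n) → Set
IsDMSystem d m ps = (length ps ≤ m) × All (DegLe d) ps

NonConstantOn : ∀ {n} → (Point n → Bool) → List (Poly n) → Set
NonConstantOn f ps =
  Σ _ λ x → Σ _ λ y → T (inVariety ps x) × T (inVariety ps y) × (f x ≢ f y)

IsDisperser : (n d m s : ℕ) → (Point n → Bool) → Set
IsDisperser n d m s f =
  (ps : List (Poly n)) → IsDMSystem d m ps → s < varietySize ps → NonConstantOn f ps

-- "At most k functions f : {0,1}^n → {0,1} fail P": there is a list of length ≤ k
-- containing (up to pointwise equality) every function failing P.
-- Since there are 2^(2^n) functions, "Pr[P f] ≥ 1 - 1/(k+1)" is expressed by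
-- FailuresCoveredBy n P L with (k+1)·L ≤ 2^(2^n).
FailuresCoveredBy : (n : ℕ) → ((Point n → Bool) → Set) → List (Point n → Bool) → Set
FailuresCoveredBy n P L =
  (f : Point n → Bool) → ¬ P f → Any (λ g → (x : Point n) → g x ≡ f x) L

-- A function fails to be a (d,m,s)-disperser only if it is constant on a (d,m)-variety V
-- with |V| > s, and at most 2 · 2^(2^n − |V|) ≤ 2^(2^n) / 2^s functions are constant on V.
-- Expanding each equation in the K ≤ 2n^d monomials of degree ≤ d gives at most 2^(Km)
-- varieties, so the failures make up at most a 2^(Km − s) fraction of all functions, and
-- 2^(Km − s) ≤ 2^(−n) because n + Km ≤ 3dmn^d < s.  If d = 0 or m = 0 every variety is
-- empty or the whole cube, and only the two constant functions can fail.

module Submission where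

open import Defs
open import Data.Bool using (Bool; true; false; not; _∧_; _xor_; T; if_then_else_)
open import Data.Bool.Properties using (T?; T-≡; xor-assoc; xor-comm; xor-same) renaming (_≟_ to _≟ᵇ_)
open import Data.Empty using (⊥-elim)
open import Data.Nat using (ℕ; zero; suc; _+_; _*_; _^_; _≤_; _<_; _≥_; z≤n; s≤s; _<?_)
open import Data.Nat.Properties
open import Data.Nat.Tactic.RingSolver using (solve-∀)
open import Algebra.Properties.CommutativeSemigroup +-commutativeSemigroup using () renaming (interchange to +-interchange)
open import Data.List using (List; []; _∷_; length; filter; map; _++_; concatMap; cartesianProductWith)
open import Data.List.Properties using (length-++; length-map; filter-++; length-filter)
open import Data.List.Membership.Propositional using (_∈_)
open import Data.List.Relation.Unary.All as All using (All; []; _∷_; all?)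
open import Data.List.Relation.Unary.All.Properties using (all-filter)
open import Data.List.Relation.Unary.Any as Any using (Any; here; there; any?; satisfied)
import Data.List.Relation.Unary.Any.Properties as Anyₚ
open import Data.Vec using (Vec; []; _∷_; replicate; updateAt)
open import Data.Product using (Σ; ∃; ∃-syntax; _×_; _,_)
open import Data.Sum using (_⊎_; inj₁; inj₂; [_,_])
open import Function using (_∘_; const; id)
open import Function.Bundles using (Equivalence)
open import Relation.Binary.PropositionalEquality using (_≡_; _≢_; _≗_; refl; sym; trans; cong; cong₂; subst; module ≡-Reasoning)
open import Relation.Nullary using (Dec; yes; no; _×-dec_; ¬?)
import Relation.Nullary.Decidable as Dec

private
  variable
    A B C : Set

length-cartesianProductWith : (f : A → B → C) (xs : List A) (ys : List B) →
  length (cartesianProductWith f xs ys) ≡ length xs * length ys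
length-cartesianProductWith f [] ys = refl
length-cartesianProductWith f (x ∷ xs) ys = begin
  length (map (f x) ys ++ cartesianProductWith f xs ys)  ≡⟨ length-++ (map (f x) ys) ⟩
  length (map (f x) ys) + length (cartesianProductWith f xs ys)
    ≡⟨ cong₂ _+_ (length-map (f x) ys) (length-cartesianProductWith f xs ys) ⟩
  length ys + length xs * length ys  ∎
  where open ≡-Reasoning

length-concatMap-≤ : ∀ {w c} (f : A → List B) {xs : List A} →
  All (λ x → length (f x) * w ≤ c) xs → length (concatMap f xs) * w ≤ length xs * c
length-concatMap-≤ f [] = z≤n
length-concatMap-≤ {w = w} {c} f {x ∷ xs} (fx ∷ fxs) = begin
  length (f x ++ concatMap f xs) * w               ≡⟨ cong (_* w) (length-++ (f x)) ⟩
  (length (f x) + length (concatMap f xs)) * w     ≡⟨ *-distribʳ-+ w (length (f x)) _ ⟩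
  length (f x) * w + length (concatMap f xs) * w   ≤⟨ +-mono-≤ fx (length-concatMap-≤ f fxs) ⟩
  c + length xs * c                                ∎
  where open ≤-Reasoning

Any-filter⁺ : ∀ {P Q : A → Set} (Q? : ∀ x → Dec (Q x)) {xs} → (∀ {x} → P x → Q x) →
  Any P xs → Any P (filter Q? xs)
Any-filter⁺ Q? P⇒Q p = [ id , (λ ¬Q → ⊥-elim (¬Q (P⇒Q (Anyₚ.lookup-result p)))) ] (Anyₚ.filter⁺ Q? p)

length-filter-map : ∀ {P : B → Set} (P? : ∀ y → Dec (P y)) (f : A → B) (xs : List A) →
  length (filter P? (map f xs)) ≡ length (filter (P? ∘ f) xs)
length-filter-map P? f [] = refl
length-filter-map P? f (x ∷ xs) with Dec.does (P? (f x))
... | true = cong suc (length-filter-map P? f xs)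
... | false = length-filter-map P? f xs

lists : List A → ℕ → List (List A)
lists xs zero = [] ∷ []
lists xs (suc m) = cartesianProductWith _∷_ xs (lists xs m)

length-lists : (xs : List A) (m : ℕ) → length (lists xs m) ≡ length xs ^ m
length-lists xs zero = refl
length-lists xs (suc m) =
  trans (length-cartesianProductWith _∷_ xs (lists xs m)) (cong (length xs *_) (length-lists xs m))

∷-∈-lists : ∀ {x ys} {xs : List A} {m} → x ∈ xs → ys ∈ lists xs m → x ∷ ys ∈ lists xs (suc m)
∷-∈-lists = Anyₚ.cartesianProductWith⁺ _∷_ (λ { refl refl → refl })

allPoints-complete : ∀ {n} (x : Point n) → x ∈ allPoints n
allPoints-complete [] = here refl
allPoints-complete (false ∷ x) = Anyₚ.++⁺ˡ (Anyₚ.map⁺ (Any.map (cong (false ∷_)) (allPoints-complete x)))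
allPoints-complete {suc n} (true ∷ x) =
  Anyₚ.++⁺ʳ (map (false ∷_) (allPoints n)) (Anyₚ.map⁺ (Any.map (cong (true ∷_)) (allPoints-complete x)))

length-allPoints : (n : ℕ) → length (allPoints n) ≡ 2 ^ n
length-allPoints zero = refl
length-allPoints (suc n) = begin
  length (map (false ∷_) (allPoints n) ++ map (true ∷_) (allPoints n))
    ≡⟨ length-++ (map (false ∷_) (allPoints n)) ⟩
  length (map (false ∷_) (allPoints n)) + length (map (true ∷_) (allPoints n))
    ≡⟨ cong₂ _+_ (length-map _ (allPoints n)) (length-map _ (allPoints n)) ⟩
  length (allPoints n) + length (allPoints n)
    ≡⟨ cong₂ _+_ (length-allPoints n) (trans (length-allPoints n) (sym (+-identityʳ (2 ^ n)))) ⟩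
  2 ^ n + (2 ^ n + 0)  ∎
  where open ≡-Reasoning

_≗?_ : ∀ {n} (f g : Point n → Bool) → Dec (f ≗ g)
_≗?_ {n} f g = Dec.map′ (λ all x → All.lookup all (allPoints-complete x))
                        (λ f≗g → All.tabulate (λ {x} _ → f≗g x))
                        (all? (λ x → f x ≟ᵇ g x) (allPoints n))

ConstantOn : ∀ {n} → (Point n → Bool) → (Point n → Bool) → Bool → Set
ConstantOn V f b = ∀ x → T (V x) → f x ≡ b

constant-or-separated : ∀ {n} (V f : Point n → Bool) (x₀ : Point n) →
  (∃[ y ] T (V y) × f x₀ ≢ f y) ⊎ ConstantOn V f (f x₀)
constant-or-separated {n} V f x₀ with any? (λ y → T? (V y) ×-dec ¬? (f x₀ ≟ᵇ f y)) (allPoints n)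
... | yes separated = inj₁ (satisfied separated)
... | no ¬separated = inj₂ constant
  where
  constant : ConstantOn V f (f x₀)
  constant x Vx with f x ≟ᵇ f x₀
  ... | yes eq = eq
  ... | no neq = ⊥-elim (¬separated (Any.map (λ { refl → Vx , neq ∘ sym }) (allPoints-complete x)))

size : (n : ℕ) → (Point n → Bool) → ℕ
size zero V = if V [] then 1 else 0
size (suc n) V = size n (V ∘ (false ∷_)) + size n (V ∘ (true ∷_))

size-filter : (n : ℕ) (V : Point n → Bool) → length (filter (T? ∘ V) (allPoints n)) ≡ size n V
size-filter zero V with V []
... | true = refl
... | false = refl
size-filter (suc n) V = begin
  length (filter (T? ∘ V) (map (false ∷_) (allPoints n) ++ map (true ∷_) (allPoints n)))
    ≡⟨ cong length (filter-++ (T? ∘ V) (map (false ∷_) (allPoints n)) _) ⟩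
  length (filter (T? ∘ V) (map (false ∷_) (allPoints n)) ++ filter (T? ∘ V) (map (true ∷_) (allPoints n)))
    ≡⟨ length-++ (filter (T? ∘ V) (map (false ∷_) (allPoints n))) ⟩
  length (filter (T? ∘ V) (map (false ∷_) (allPoints n))) + length (filter (T? ∘ V) (map (true ∷_) (allPoints n)))
    ≡⟨ cong₂ _+_ (trans (length-filter-map (T? ∘ V) (false ∷_) (allPoints n)) (size-filter n _))
                 (trans (length-filter-map (T? ∘ V) (true ∷_) (allPoints n)) (size-filter n _)) ⟩
  size (suc n) V  ∎
  where open ≡-Reasoning

varietySize≡size : ∀ {n} (ps : List (Poly n)) → varietySize ps ≡ size n (inVariety ps)
varietySize≡size {n} ps = size-filter n (inVariety ps)

size-cong : ∀ {n} {V W : Point n → Bool} → V ≗ W → size n V ≡ size n W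
size-cong {zero} V≗W rewrite V≗W [] = refl
size-cong {suc n} V≗W = cong₂ _+_ (size-cong (V≗W ∘ (false ∷_))) (size-cong (V≗W ∘ (true ∷_)))

size-complement : (n : ℕ) (V : Point n → Bool) → size n (not ∘ V) + size n V ≡ 2 ^ n
size-complement zero V with V []
... | true = refl
... | false = refl
size-complement (suc n) V = begin
  (size n (not ∘ V₀) + size n (not ∘ V₁)) + (size n V₀ + size n V₁)
    ≡⟨ +-interchange (size n (not ∘ V₀)) (size n (not ∘ V₁)) (size n V₀) (size n V₁) ⟩
  (size n (not ∘ V₀) + size n V₀) + (size n (not ∘ V₁) + size n V₁)
    ≡⟨ cong₂ _+_ (size-complement n V₀) (trans (size-complement n V₁) (sym (+-identityʳ (2 ^ n)))) ⟩
  2 ^ suc n  ∎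
  where
  open ≡-Reasoning
  V₀ = V ∘ (false ∷_)
  V₁ = V ∘ (true ∷_)

size-true : (n : ℕ) → size n (const true) ≡ 2 ^ n
size-true zero = refl
size-true (suc n) = cong₂ _+_ (size-true n) (trans (size-true n) (sym (+-identityʳ (2 ^ n))))

filter-witness : ∀ {P : A → Set} (P? : ∀ x → Dec (P x)) (xs : List A) → 0 < length (filter P? xs) → ∃ P
filter-witness P? (x ∷ xs) nonempty with P? x
... | yes Px = x , Px
... | no _ = filter-witness P? xs nonempty

inhabited-if-large : ∀ {n s} (ps : List (Poly n)) → s < varietySize ps → ∃[ x ] T (inVariety ps x)
inhabited-if-large {n} ps large = filter-witness (T? ∘ inVariety ps) (allPoints n) (≤-trans (s≤s z≤n) large)

glue : ∀ {n} → (Point n → Bool) → (Point n → Bool) → Point (suc n) → Bool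
glue g₀ g₁ (false ∷ x) = g₀ x
glue g₀ g₁ (true ∷ x) = g₁ x

equalOn : (n : ℕ) → (Point n → Bool) → Bool → List (Point n → Bool)
equalOn zero V b = if V [] then const b ∷ [] else const false ∷ const true ∷ []
equalOn (suc n) V b = cartesianProductWith glue (equalOn n (V ∘ (false ∷_)) b) (equalOn n (V ∘ (true ∷_)) b)

equalOn-complete : ∀ {n} (V : Point n → Bool) (b : Bool) (f : Point n → Bool) →
  ConstantOn V f b → Any (_≗ f) (equalOn n V b)
equalOn-complete {zero} V b f constant with V [] in V[]
... | true = here λ { [] → sym (constant [] (subst T (sym V[]) _)) }
... | false with f [] in f[]
...   | false = here λ { [] → sym f[] }
...   | true = there (here λ { [] → sym f[] })
equalOn-complete {suc n} V b f constant =
  Anyₚ.cartesianProductWith⁺ glue glue-≗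
    (equalOn-complete (V ∘ (false ∷_)) b (f ∘ (false ∷_)) (constant ∘ (false ∷_)))
    (equalOn-complete (V ∘ (true ∷_)) b (f ∘ (true ∷_)) (constant ∘ (true ∷_)))
  where
  glue-≗ : ∀ {g₀ g₁} → g₀ ≗ f ∘ (false ∷_) → g₁ ≗ f ∘ (true ∷_) → glue g₀ g₁ ≗ f
  glue-≗ g₀≗ g₁≗ (false ∷ x) = g₀≗ x
  glue-≗ g₀≗ g₁≗ (true ∷ x) = g₁≗ x

length-equalOn : (n : ℕ) (V : Point n → Bool) (b : Bool) → length (equalOn n V b) ≡ 2 ^ size n (not ∘ V)
length-equalOn zero V b with V []
... | true = refl
... | false = refl
length-equalOn (suc n) V b = begin
  length (cartesianProductWith glue (equalOn n V₀ b) (equalOn n V₁ b))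
    ≡⟨ length-cartesianProductWith glue (equalOn n V₀ b) (equalOn n V₁ b) ⟩
  length (equalOn n V₀ b) * length (equalOn n V₁ b)
    ≡⟨ cong₂ _*_ (length-equalOn n V₀ b) (length-equalOn n V₁ b) ⟩
  2 ^ size n (not ∘ V₀) * 2 ^ size n (not ∘ V₁)
    ≡⟨ ^-distribˡ-+-* 2 (size n (not ∘ V₀)) (size n (not ∘ V₁)) ⟨
  2 ^ size (suc n) (not ∘ V)  ∎
  where
  open ≡-Reasoning
  V₀ = V ∘ (false ∷_)
  V₁ = V ∘ (true ∷_)

length-equalOn-scaled : (n : ℕ) (V : Point n → Bool) (b : Bool) → length (equalOn n V b) * 2 ^ size n V ≡ 2 ^ 2 ^ n
length-equalOn-scaled n V b = begin
  length (equalOn n V b) * 2 ^ size n V     ≡⟨ cong (_* 2 ^ size n V) (length-equalOn n V b) ⟩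
  2 ^ size n (not ∘ V) * 2 ^ size n V       ≡⟨ ^-distribˡ-+-* 2 (size n (not ∘ V)) (size n V) ⟨
  2 ^ (size n (not ∘ V) + size n V)         ≡⟨ cong (2 ^_) (size-complement n V) ⟩
  2 ^ 2 ^ n                                 ∎
  where open ≡-Reasoning

constantOn : (n : ℕ) → (Point n → Bool) → List (Point n → Bool)
constantOn n V = equalOn n V true ++ equalOn n V false

constantOn-complete : ∀ {n} (V : Point n → Bool) (b : Bool) (f : Point n → Bool) →
  ConstantOn V f b → Any (_≗ f) (constantOn n V)
constantOn-complete V true f constant = Anyₚ.++⁺ˡ (equalOn-complete V true f constant)
constantOn-complete {n} V false f constant = Anyₚ.++⁺ʳ (equalOn n V true) (equalOn-complete V false f constant)

length-constantOn-scaled : (n : ℕ) (V : Point n → Bool) → length (constantOn n V) * 2 ^ size n V ≡ 2 * 2 ^ 2 ^ n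
length-constantOn-scaled n V = begin
  length (equalOn n V true ++ equalOn n V false) * 2 ^ size n V
    ≡⟨ cong (_* 2 ^ size n V) (length-++ (equalOn n V true)) ⟩
  (length (equalOn n V true) + length (equalOn n V false)) * 2 ^ size n V
    ≡⟨ *-distribʳ-+ (2 ^ size n V) (length (equalOn n V true)) _ ⟩
  length (equalOn n V true) * 2 ^ size n V + length (equalOn n V false) * 2 ^ size n V
    ≡⟨ cong₂ _+_ (length-equalOn-scaled n V true) (trans (length-equalOn-scaled n V false) (sym (+-identityʳ _))) ⟩
  2 * 2 ^ 2 ^ n  ∎
  where open ≡-Reasoning

CoversConstantOnLargeVarieties : (n d m s : ℕ) → List (Point n → Bool) → Set
CoversConstantOnLargeVarieties n d m s L =
  ∀ f ps b → IsDMSystem d m ps → s < varietySize ps → ConstantOn (inVariety ps) f b → Any (_≗ f) L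

-- Constructively ¬ IsDisperser yields no variety, so we decide f ∈ L instead and
-- show that f ∉ L makes f a disperser.
failuresCoveredBy : ∀ {n d m s} (L : List (Point n → Bool)) →
  CoversConstantOnLargeVarieties n d m s L → FailuresCoveredBy n (IsDisperser n d m s) L
failuresCoveredBy {n} {d} {m} {s} L covers f non-disperser with any? (_≗? f) L
... | yes f∈L = f∈L
... | no f∉L = ⊥-elim (non-disperser disperser)
  where
  disperser : IsDisperser n d m s f
  disperser ps system large with inhabited-if-large ps large
  ... | x₀ , Vx₀ with constant-or-separated (inVariety ps) f x₀
  ...   | inj₁ (y , Vy , fx₀≢fy) = x₀ , y , Vx₀ , Vy , fx₀≢fy
  ...   | inj₂ constant = ⊥-elim (f∉L (covers f ps (f x₀) system large constant))

VarietiesCoveredBy : (n d m s : ℕ) → List (Point n → Bool) → Set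
VarietiesCoveredBy n d m s Vs = ∀ ps → IsDMSystem d m ps → s < varietySize ps → Any (_≗ inVariety ps) Vs

constantOn-covers : ∀ {n d m s} (Vs : List (Point n → Bool)) →
  VarietiesCoveredBy n d m s Vs → CoversConstantOnLargeVarieties n d m s (concatMap (constantOn n) Vs)
constantOn-covers Vs covers f ps b system large constant =
  Anyₚ.concatMap⁺ (constantOn _)
    (Any.map (λ {V} V≗ → constantOn-complete V b f (λ x Vx → constant x (subst T (V≗ x) Vx)))
             (covers ps system large))

length-concatMap-constantOn : ∀ {n} r (Vs : List (Point n → Bool)) → All (λ V → r ≤ size n V) Vs →
  length (concatMap (constantOn n) Vs) * 2 ^ r ≤ length Vs * (2 * 2 ^ 2 ^ n)
length-concatMap-constantOn {n} r Vs large = length-concatMap-≤ (constantOn n) (All.map bound large)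
  where
  bound : ∀ {V} → r ≤ size n V → length (constantOn n V) * 2 ^ r ≤ 2 * 2 ^ 2 ^ n
  bound {V} r≤ = ≤-trans (*-monoʳ-≤ (length (constantOn n V)) (^-monoʳ-≤ 2 r≤))
                         (≤-reflexive (length-constantOn-scaled n V))

few-failures : ∀ {n d m s} k r (Vs : List (Point n → Bool)) →
  All (λ V → r ≤ size n V) Vs → VarietiesCoveredBy n d m s Vs → suc k * (2 * length Vs) ≤ 2 ^ r →
  Σ (List (Point n → Bool)) λ L → FailuresCoveredBy n (IsDisperser n d m s) L × suc k * length L ≤ 2 ^ 2 ^ n
few-failures {n} k r Vs large covers few = L , failuresCoveredBy L (constantOn-covers Vs covers) , bound
  where
  L = concatMap (constantOn n) Vs
  P = 2 ^ 2 ^ n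
  regroup : ∀ a b c → a * (b * (2 * c)) ≡ a * (2 * b) * c
  regroup = solve-∀
  bound : suc k * length L ≤ P
  bound = *-cancelʳ-≤ (suc k * length L) P (2 ^ r) {{m^n≢0 2 r}} (begin
    suc k * length L * 2 ^ r            ≡⟨ *-assoc (suc k) (length L) (2 ^ r) ⟩
    suc k * (length L * 2 ^ r)          ≤⟨ *-monoʳ-≤ (suc k) (length-concatMap-constantOn r Vs large) ⟩
    suc k * (length Vs * (2 * P))       ≡⟨ regroup (suc k) (length Vs) P ⟩
    suc k * (2 * length Vs) * P         ≤⟨ *-monoˡ-≤ P few ⟩
    2 ^ r * P                           ≡⟨ *-comm (2 ^ r) P ⟩
    P * 2 ^ r                           ∎)
    where open ≤-Reasoning

monomialsUpTo : (n d : ℕ) → List (Monomial n)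
monomialsUpTo zero d = [] ∷ []
monomialsUpTo (suc n) zero = map (false ∷_) (monomialsUpTo n zero)
monomialsUpTo (suc n) (suc d) = map (false ∷_) (monomialsUpTo n (suc d)) ++ map (true ∷_) (monomialsUpTo n d)

monomialsUpTo-complete : ∀ {n} d (μ : Monomial n) → degM μ ≤ d → μ ∈ monomialsUpTo n d
monomialsUpTo-complete d [] _ = here refl
monomialsUpTo-complete zero (false ∷ μ) deg =
  Anyₚ.map⁺ (Any.map (cong (false ∷_)) (monomialsUpTo-complete zero μ deg))
monomialsUpTo-complete (suc d) (false ∷ μ) deg =
  Anyₚ.++⁺ˡ (Anyₚ.map⁺ (Any.map (cong (false ∷_)) (monomialsUpTo-complete (suc d) μ deg)))
monomialsUpTo-complete {suc n} (suc d) (true ∷ μ) (s≤s deg) =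
  Anyₚ.++⁺ʳ (map (false ∷_) (monomialsUpTo n (suc d))) (Anyₚ.map⁺ (Any.map (cong (true ∷_)) (monomialsUpTo-complete d μ deg)))

length-monomialsUpTo-0 : (n : ℕ) → length (monomialsUpTo n 0) ≡ 1
length-monomialsUpTo-0 zero = refl
length-monomialsUpTo-0 (suc n) = trans (length-map (false ∷_) (monomialsUpTo n 0)) (length-monomialsUpTo-0 n)

length-monomialsUpTo : (n d : ℕ) → length (monomialsUpTo (suc n) d) ≤ 2 * suc n ^ d
length-monomialsUpTo n zero = ≤-trans (≤-reflexive (length-monomialsUpTo-0 (suc n))) (s≤s z≤n)
length-monomialsUpTo zero (suc d) rewrite ^-zeroˡ d = ≤-refl
length-monomialsUpTo (suc n) (suc d) = begin
  length (map (false ∷_) (monomialsUpTo (suc n) (suc d)) ++ map (true ∷_) (monomialsUpTo (suc n) d))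
    ≡⟨ length-++ (map (false ∷_) (monomialsUpTo (suc n) (suc d))) ⟩
  length (map (false ∷_) (monomialsUpTo (suc n) (suc d))) + length (map (true ∷_) (monomialsUpTo (suc n) d))
    ≡⟨ cong₂ _+_ (length-map (false ∷_) (monomialsUpTo (suc n) (suc d))) (length-map (true ∷_) (monomialsUpTo (suc n) d)) ⟩
  length (monomialsUpTo (suc n) (suc d)) + length (monomialsUpTo (suc n) d)
    ≤⟨ +-mono-≤ (length-monomialsUpTo n (suc d)) (length-monomialsUpTo n d) ⟩
  2 * (suc n * suc n ^ d) + 2 * suc n ^ d
    ≡⟨ regroup (suc n) (suc n ^ d) ⟩
  2 * (suc (suc n) * suc n ^ d)
    ≤⟨ *-monoʳ-≤ 2 (*-monoʳ-≤ (suc (suc n)) (^-monoˡ-≤ d (n≤1+n (suc n)))) ⟩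
  2 * suc (suc n) ^ suc d  ∎
  where
  open ≤-Reasoning
  regroup : ∀ a e → 2 * (a * e) + 2 * e ≡ 2 * (suc a * e)
  regroup = solve-∀

polynomial : ∀ {n} (ms : List (Monomial n)) → Vec Bool (length ms) → Poly n
polynomial [] [] = []
polynomial (μ ∷ ms) (false ∷ c) = polynomial ms c
polynomial (μ ∷ ms) (true ∷ c) = μ ∷ polynomial ms c

polynomial-zero : ∀ {n} (ms : List (Monomial n)) → polynomial ms (replicate (length ms) false) ≡ []
polynomial-zero [] = refl
polynomial-zero (μ ∷ ms) = polynomial-zero ms

evalP-flip : ∀ {n} {μ : Monomial n} {ms} (μ∈ : μ ∈ ms) (c : Vec Bool (length ms)) (x : Point n) →
  evalP (polynomial ms (updateAt c (Any.index μ∈) not)) x ≡ evalM μ x xor evalP (polynomial ms c) x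
evalP-flip (here refl) (false ∷ c) x = refl
evalP-flip {μ = μ} {ms = _ ∷ ms} (here refl) (true ∷ c) x = begin
  evalP (polynomial ms c) x                              ≡⟨ cong (_xor evalP (polynomial ms c) x) (xor-same (evalM μ x)) ⟨
  (evalM μ x xor evalM μ x) xor evalP (polynomial ms c) x ≡⟨ xor-assoc (evalM μ x) _ _ ⟩
  evalM μ x xor (evalM μ x xor evalP (polynomial ms c) x) ∎
  where open ≡-Reasoning
evalP-flip (there μ∈) (false ∷ c) x = evalP-flip μ∈ c x
evalP-flip {μ = μ} {ms = ν ∷ ms} (there μ∈) (true ∷ c) x = begin
  evalM ν x xor evalP (polynomial ms (updateAt c (Any.index μ∈) not)) x
    ≡⟨ cong (evalM ν x xor_) (evalP-flip μ∈ c x) ⟩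
  evalM ν x xor (evalM μ x xor evalP (polynomial ms c) x)
    ≡⟨ xor-assoc (evalM ν x) _ _ ⟨
  (evalM ν x xor evalM μ x) xor evalP (polynomial ms c) x
    ≡⟨ cong (_xor evalP (polynomial ms c) x) (xor-comm (evalM ν x) (evalM μ x)) ⟩
  (evalM μ x xor evalM ν x) xor evalP (polynomial ms c) x
    ≡⟨ xor-assoc (evalM μ x) _ _ ⟩
  evalM μ x xor (evalM ν x xor evalP (polynomial ms c) x)  ∎
  where open ≡-Reasoning

coefficients : ∀ {n} (ms : List (Monomial n)) (p : Poly n) → All (_∈ ms) p →
  ∃[ c ] evalP (polynomial ms c) ≗ evalP p
coefficients ms [] [] = replicate (length ms) false , λ x → cong (λ q → evalP q x) (polynomial-zero ms)
coefficients ms (μ ∷ p) (μ∈ ∷ p⊆) =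
  let c , c≗ = coefficients ms p p⊆
  in updateAt c (Any.index μ∈) not , λ x → trans (evalP-flip μ∈ c x) (cong (evalM μ x xor_) (c≗ x))

varietyOf : ∀ {n} (ms : List (Monomial n)) → List (Vec Bool (length ms)) → Point n → Bool
varietyOf ms cs = inVariety (map (polynomial ms) cs)

HasCoefficients : ∀ {n} (ms : List (Monomial n)) (m : ℕ) → List (Poly n) → Set
HasCoefficients ms m ps = ∃[ cs ] cs ∈ lists (allPoints (length ms)) m × varietyOf ms cs ≗ inVariety ps

HasCoefficients-∷ : ∀ {n} {ms : List (Monomial n)} {m ps} (p : Poly n) → All (_∈ ms) p →
  HasCoefficients ms m ps → HasCoefficients ms (suc m) (p ∷ ps)
HasCoefficients-∷ {ms = ms} {m} {ps} p p⊆ (cs , cs∈ , cs≗) =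
  let c , c≗ = coefficients ms p p⊆
  in c ∷ cs , ∷-∈-lists {m = m} (allPoints-complete c) cs∈ , λ x → cong₂ (λ a b → not a ∧ b) (c≗ x) (cs≗ x)

-- Systems with fewer than m equations are padded with the zero polynomial.
hasCoefficients : ∀ {n} (ms : List (Monomial n)) m (ps : List (Poly n)) →
  length ps ≤ m → All (All (_∈ ms)) ps → HasCoefficients ms m ps
hasCoefficients ms zero [] _ _ = [] , here refl , λ _ → refl
hasCoefficients ms (suc m) [] _ _ = HasCoefficients-∷ {ms = ms} {m} {[]} [] [] (hasCoefficients ms m [] z≤n [])
hasCoefficients ms (suc m) (p ∷ ps) (s≤s l) (p⊆ ∷ ps⊆) = HasCoefficients-∷ {ms = ms} {m} {ps} p p⊆ (hasCoefficients ms m ps l ps⊆)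

candidateVarieties : (n d m : ℕ) → List (Point n → Bool)
candidateVarieties n d m = map (varietyOf ms) (lists (allPoints (length ms)) m)
  where ms = monomialsUpTo n d

candidateVarieties-complete : ∀ {n d m} (ps : List (Poly n)) → IsDMSystem d m ps →
  Any (_≗ inVariety ps) (candidateVarieties n d m)
candidateVarieties-complete {n} {d} {m} ps (l , degs) =
  let cs , cs∈ , cs≗ = hasCoefficients ms m ps l (All.map (All.map (λ {μ} → monomialsUpTo-complete d μ)) degs)
  in Anyₚ.map⁺ (Any.map (λ { refl → cs≗ }) cs∈)
  where ms = monomialsUpTo n d

length-candidateVarieties : (n d m : ℕ) → length (candidateVarieties n d m) ≡ 2 ^ (length (monomialsUpTo n d) * m)
length-candidateVarieties n d m = begin
  length (map (varietyOf ms) (lists (allPoints K) m))  ≡⟨ length-map (varietyOf ms) (lists (allPoints K) m) ⟩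
  length (lists (allPoints K) m)                       ≡⟨ length-lists (allPoints K) m ⟩
  length (allPoints K) ^ m                             ≡⟨ cong (_^ m) (length-allPoints K) ⟩
  (2 ^ K) ^ m                                          ≡⟨ ^-*-assoc 2 K m ⟩
  2 ^ (K * m)                                          ∎
  where
  open ≡-Reasoning
  ms = monomialsUpTo n d
  K = length ms

largeVarieties : (n d m s : ℕ) → List (Point n → Bool)
largeVarieties n d m s = filter (λ V → s <? size n V) (candidateVarieties n d m)

largeVarieties-complete : ∀ {n d m s} → VarietiesCoveredBy n d m s (largeVarieties n d m s)
largeVarieties-complete {n} {s = s} ps system large =
  Any-filter⁺ (λ V → s <? size n V) (λ V≗ → subst (s <_) (trans (varietySize≡size ps) (size-cong (sym ∘ V≗))) large)
              (candidateVarieties-complete ps system)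

evalM-degree0 : ∀ {n} (μ : Monomial n) → degM μ ≤ 0 → (x : Point n) → evalM μ x ≡ true
evalM-degree0 [] _ [] = refl
evalM-degree0 (false ∷ μ) deg (_ ∷ x) = evalM-degree0 μ deg x

evalP-degree0 : ∀ {n} (p : Poly n) → DegLe 0 p → (x y : Point n) → evalP p x ≡ evalP p y
evalP-degree0 [] [] x y = refl
evalP-degree0 (μ ∷ p) (deg ∷ degs) x y =
  cong₂ _xor_ (trans (evalM-degree0 μ deg x) (sym (evalM-degree0 μ deg y))) (evalP-degree0 p degs x y)

ConstantVarieties : (n d m : ℕ) → Set
ConstantVarieties n d m = ∀ ps → IsDMSystem {n} d m ps → ∀ x y → inVariety ps x ≡ inVariety ps y

degree0-constant : ∀ {n m} → ConstantVarieties n 0 m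
degree0-constant [] _ x y = refl
degree0-constant {m = suc m} (p ∷ ps) (s≤s l , deg ∷ degs) x y =
  cong₂ (λ a b → not a ∧ b) (evalP-degree0 p deg x y) (degree0-constant {m = m} ps (l , degs) x y)

no-equations-constant : ∀ {n d} → ConstantVarieties n d 0
no-equations-constant [] _ x y = refl

constant-covered-by-full : ∀ {n d m s} → ConstantVarieties n d m → VarietiesCoveredBy n d m s (const true ∷ [])
constant-covered-by-full constant ps system large =
  let x₀ , Vx₀ = inhabited-if-large ps large
  in here λ y → sym (trans (constant ps system y x₀) (Equivalence.to T-≡ Vx₀))

n<2^n : ∀ n → n < 2 ^ n
n<2^n zero = s≤s z≤n
n<2^n (suc n) = +-mono-≤ (m^n>0 2 n) (≤-trans (n<2^n n) (m≤m+n (2 ^ n) 0))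

constant-case-bound : ∀ {n k} → suc k ≤ n → suc k * (2 * 1) ≤ 2 ^ 2 ^ n
constant-case-bound {n} {k} k<n = begin
  suc k * 2   ≤⟨ *-monoˡ-≤ 2 (≤-trans k<n (<⇒≤ (n<2^n n))) ⟩
  2 ^ n * 2   ≡⟨ *-comm (2 ^ n) 2 ⟩
  2 ^ suc n   ≤⟨ ^-monoʳ-≤ 2 (n<2^n n) ⟩
  2 ^ 2 ^ n   ∎
  where open ≤-Reasoning

few-failures-constant : ∀ {n d m s} k → suc k ≤ n → ConstantVarieties n d m →
  Σ (List (Point n → Bool)) λ L → FailuresCoveredBy n (IsDisperser n d m s) L × suc k * length L ≤ 2 ^ 2 ^ n
few-failures-constant {n} k k<n constant =
  few-failures k (2 ^ n) (const true ∷ []) (≤-reflexive (sym (size-true n)) ∷ [])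
               (constant-covered-by-full constant) (constant-case-bound k<n)

general-case-bound : ∀ {n k v e s} → suc k ≤ n → v ≤ 2 ^ e → n + e ≤ s → suc k * (2 * v) ≤ 2 ^ suc s
general-case-bound {n} {k} {v} {e} {s} k<n v≤ n+e≤s = begin
  suc k * (2 * v)          ≤⟨ *-mono-≤ (≤-trans k<n (<⇒≤ (n<2^n n))) (*-monoʳ-≤ 2 v≤) ⟩
  2 ^ n * (2 * 2 ^ e)      ≡⟨ regroup (2 ^ n) (2 ^ e) ⟩
  2 * (2 ^ n * 2 ^ e)      ≡⟨ cong (2 *_) (^-distribˡ-+-* 2 n e) ⟨
  2 * 2 ^ (n + e)          ≤⟨ *-monoʳ-≤ 2 (^-monoʳ-≤ 2 n+e≤s) ⟩
  2 ^ suc s                ∎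
  where
  open ≤-Reasoning
  regroup : ∀ a b → a * (2 * b) ≡ 2 * (a * b)
  regroup = solve-∀

exponent-bound : ∀ n d m K s → K ≤ 2 * suc n ^ suc d → 3 * suc d * suc m * suc n ^ suc d < s →
  suc n + K * suc m ≤ s
exponent-bound n d m K s K≤ h = begin
  N + K * M                      ≤⟨ +-mono-≤ (≤-trans N≤X X≤DMX) (*-monoˡ-≤ M K≤) ⟩
  D * (M * X) + 2 * X * M        ≤⟨ +-monoʳ-≤ (D * (M * X)) (≤-trans (≤-reflexive (regroup₁ X M)) (*-monoʳ-≤ 2 (m≤n*m (M * X) D))) ⟩
  D * (M * X) + 2 * (D * (M * X)) ≡⟨ regroup₂ D M X ⟨
  3 * D * M * X                  ≤⟨ <⇒≤ h ⟩
  s                              ∎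
  where
  open ≤-Reasoning
  N = suc n
  D = suc d
  M = suc m
  X = N ^ D
  N≤X : N ≤ X
  N≤X = ≤-trans (≤-reflexive (sym (*-identityʳ N))) (^-monoʳ-≤ N {1} {D} (s≤s z≤n))
  X≤DMX : X ≤ D * (M * X)
  X≤DMX = ≤-trans (m≤n*m X M) (m≤n*m (M * X) D)
  regroup₁ : ∀ x y → 2 * x * y ≡ 2 * (y * x)
  regroup₁ = solve-∀
  regroup₂ : ∀ a b x → 3 * a * b * x ≡ a * (b * x) + 2 * (a * (b * x))
  regroup₂ = solve-∀

few-non-dispersers : ∀ n d m s k → 3 * d * m * n ^ d < s → suc k ≤ n →
  Σ (List (Point n → Bool)) λ L → FailuresCoveredBy n (IsDisperser n d m s) L × suc k * length L ≤ 2 ^ 2 ^ n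
few-non-dispersers n zero m s k _ k<n = few-failures-constant k k<n degree0-constant
few-non-dispersers n (suc d) zero s k _ k<n = few-failures-constant k k<n no-equations-constant
few-non-dispersers (suc n) (suc d) (suc m) s k h k<n =
  few-failures k (suc s) (largeVarieties N D M s) (all-filter large? candidates) largeVarieties-complete
    (general-case-bound k<n (≤-trans (length-filter large? candidates) (≤-reflexive (length-candidateVarieties N D M)))
                            (exponent-bound n d m _ s (length-monomialsUpTo n D) h))
  where
  N = suc n
  D = suc d
  M = suc m
  candidates = candidateVarieties N D M
  large? = λ V → s <? size N V

lemma5 : (d m s : ℕ → ℕ) →
         ((n : ℕ) → 3 * d n * m n * n ^ d n < s n) →
         (k : ℕ) → Σ ℕ λ N → (n : ℕ) → n ≥ N →
           Σ (List (Point n → Bool)) λ L →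
             FailuresCoveredBy n (IsDisperser n (d n) (m n) (s n)) L
             × suc k * length L ≤ 2 ^ (2 ^ n)
lemma5 d m s h k = suc k , λ n k<n → few-non-dispersers n (d n) (m n) (s n) k (h n) k<n
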